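{- For every even $k \ge 4$, the graph $M_{\rm II}(k)$ is not word-representable.
   Context: A graph $G=(V,E)$ is word-representable if there is a word $w$ over $V$ such that for all distinct $a,b\in V$, $ab\in E$ iff $a$ and $b$ alternate in $w$ (the subsequence of $w$ formed by the occurrences of $a$ and $b$ is $abab\cdots$ or $baba\cdots$). For even $k\ge4$, $M_{\rm II}(k)$ is the split graph with clique $C=\{c_1,\dots,c_k\}$, independent set $I=\{b_1,b_2,a_1,\dots,a_{k-2}\}$, and $N(b_1)=\{c_1,\dots,c_{k-2},c_k\}$, $N(b_2)=\{c_2,\dots,c_k\}$, $N(a_i)=\{c_i,c_{i+1}\}$ for $1\le i\le k-2$. -}

module Defs where

open import Level using (Level; _⊔_) renaming (suc to lsuc)
open import Data.Nat using (ℕ; zero; suc; _∸_)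
open import Data.Fin using (Fin; toℕ)
open import Data.Fin.Properties using () renaming (_≟_ to _≟ᶠ_)
open import Data.List using (List; []; _∷_; filter)
open import Data.List.Membership.Propositional using (_∈_)
open import Data.Product using (Σ; _×_)
open import Data.Unit using (⊤)
open import Data.Empty using (⊥)
open import Function.Bundles using (_⇔_)
open import Relation.Nullary using (¬_; yes; no)
open import Relation.Nullary.Decidable using (_⊎-dec_)
open import Relation.Binary.Definitions using (DecidableEquality)
open import Relation.Binary.PropositionalEquality using (_≡_; _≢_; refl; cong)

-- A list alternates if no two consecutive entries are equal
-- (for a list over at most two letters this is exactly  abab...  or  baba...).
Alternates : ∀ {a} {A : Set a} → List A → Set a
Alternates []          = Level.Lift _ ⊤
Alternates (x ∷ [])    = Level.Lift _ ⊤
Alternates (x ∷ y ∷ r) = (x ≢ y) × Alternates (y ∷ r)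

restrict : ∀ {a} {A : Set a} → DecidableEquality A → List A → A → A → List A
restrict _≟_ w x y = filter (λ z → (z ≟ x) ⊎-dec (z ≟ y)) w

WordRepresentable : ∀ {v e} (V : Set v) → DecidableEquality V → (V → V → Set e) → Set (v ⊔ e)
WordRepresentable V _≟_ E =
  Σ (List V) λ w →
    (∀ x → x ∈ w) ×
    (∀ x y → x ≢ y → (E x y ⇔ Alternates (restrict _≟_ w x y)))

-- Vertices of M_II(k).  Indices are 0-based:
--   c i  (i : Fin k)        stands for c_{i+1}
--   a i  (i : Fin (k ∸ 2))  stands for a_{i+1}
data MV (k : ℕ) : Set where
  c  : Fin k → MV k
  b₁ : MV k
  b₂ : MV k
  a  : Fin (k ∸ 2) → MV k

_≟MV_ : ∀ {k} → DecidableEquality (MV k)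
c i ≟MV c j with i ≟ᶠ j
... | yes refl = yes refl
... | no ne    = no λ { refl → ne refl }
c _ ≟MV b₁  = no λ ()
c _ ≟MV b₂  = no λ ()
c _ ≟MV a _ = no λ ()
b₁ ≟MV c _  = no λ ()
b₁ ≟MV b₁   = yes refl
b₁ ≟MV b₂   = no λ ()
b₁ ≟MV a _  = no λ ()
b₂ ≟MV c _  = no λ ()
b₂ ≟MV b₁   = no λ ()
b₂ ≟MV b₂   = yes refl
b₂ ≟MV a _  = no λ ()
a _ ≟MV c _ = no λ ()
a _ ≟MV b₁  = no λ ()
a _ ≟MV b₂  = no λ ()
a i ≟MV a j with i ≟ᶠ j
... | yes refl = yes refl
... | no ne    = no λ { refl → ne refl }

-- Neighbourhoods of the independent-set vertices in a clique vertex c_{j+1}: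
--   N(b₁) = C \ {c_{k-1}}   (0-based: j ≠ k-2)
--   N(b₂) = C \ {c_1}       (0-based: j ≠ 0)
--   N(a_{i+1}) = {c_{i+1}, c_{i+2}}  (0-based: j = i or j = i+1)
data AdjIC {k : ℕ} : MV k → Fin k → Set where
  b₁c : ∀ j → toℕ j ≢ k ∸ 2 → AdjIC b₁ j
  b₂c : ∀ j → toℕ j ≢ 0 → AdjIC b₂ j
  ac₀ : ∀ i j → toℕ j ≡ toℕ i → AdjIC (a i) j
  ac₁ : ∀ i j → toℕ j ≡ suc (toℕ i) → AdjIC (a i) j

data AdjMII {k : ℕ} : MV k → MV k → Set where
  cc : ∀ i j → i ≢ j → AdjMII (c i) (c j)
  ic : ∀ x j → AdjIC x j → AdjMII x (c j)
  ci : ∀ x j → AdjIC x j → AdjMII (c j) x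

-- Order the vertices of a graph represented by a word w by their first occurrence in w.  If x
-- and y alternate and x comes first, every prefix of w contains as many x's as y's or one more;
-- chaining these inequalities along an increasing path u < v < x < z with u z an edge shows that
-- u x and v z alternate too.  In M_II(k) this forces the two clique neighbours c_i, c_{i+1} of
-- each a_i to be consecutive when the order of the clique is read cyclically, so up to reversal
-- the clique is read as c_1 c_2 ... c_k.  Wherever this cycle is cut, b₁ (missing c_{k-1}) and
-- b₂ (missing c_1) get squeezed between the same two clique vertices, and then one of them is
-- forced to be adjacent to the clique vertex it misses.
module Submission where

open import Level using (0ℓ)
open import Data.Nat using (ℕ; zero; suc; _+_; _∸_; _≤_; _≤?_; z≤n; s≤s; s≤s⁻¹)
open import Data.Nat.Properties
  using (≤-trans; ≤-refl; ≤-antisym; <-irrefl; <-trans; <-cmp; suc-injective; m≤n⇒m≤1+n;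
         <⇒≢; <⇒≤; ≰⇒>; n<1+n; n≤1+n)
open import Data.Nat.Divisibility using (_∣_)
open import Data.Fin using (Fin; toℕ; zero; suc)
open import Data.Fin.Properties using (any?; toℕ<n)
open import Data.Fin.Induction using (spo-wellFounded)
open import Data.List using (List; []; _∷_; filter; length; inits)
open import Data.List.Properties using (filter-accept; filter-reject; filter-≐)
open import Data.List.Membership.Propositional using (_∈_)
open import Data.List.Relation.Unary.All as All using (All; []; _∷_)
open import Data.List.Relation.Unary.All.Properties using (map⁻; map⁺)
import Data.List.Relation.Unary.Any as Any
open import Data.Product using (_×_; _,_; proj₁; proj₂; ∃-syntax)
open import Data.Sum using (_⊎_; inj₁; inj₂; swap; [_,_])
open import Data.Unit using (⊤; tt)
open import Data.Empty using (⊥; ⊥-elim)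
open import Function using (_∘_; flip; _on_)
open import Function.Bundles using (_⇔_; mk⇔; Equivalence)
open import Function.Properties.Equivalence using (⇔-setoid)
open import Function.Construct.Identity using (⇔-id)
open import Function.Construct.Composition using (_⇔-∘_)
open import Induction.WellFounded using (Acc; acc)
open import Relation.Nullary using (¬_; yes; no; _⊎-dec_; _×-dec_)
open import Relation.Unary using (Decidable)
open import Relation.Binary.Definitions
  using (Symmetric; DecidableEquality; Trichotomous; tri<; tri≈; tri>)
open import Relation.Binary.Structures using (IsStrictTotalOrder)
open import Relation.Binary.Structures.Biased using (isStrictTotalOrderᶜ)
import Relation.Binary.Construct.Flip.EqAndOrd as Flip
open import Relation.Binary.PropositionalEquality using (_≡_; _≢_; refl; sym; cong; subst)
import Relation.Binary.PropositionalEquality as ≡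

open import Defs

AtMostOneAhead : ℕ → ℕ → Set
AtMostOneAhead m n = n ≤ m × m ≤ suc n

atMostOneAhead-shortcut : ∀ {a b c d} →
  AtMostOneAhead a b → AtMostOneAhead b c → AtMostOneAhead c d → AtMostOneAhead a d →
  AtMostOneAhead a c × AtMostOneAhead b d
atMostOneAhead-shortcut (b≤a , _) (c≤b , _) (d≤c , _) (_ , a≤1+d) =
  (≤-trans c≤b b≤a , ≤-trans a≤1+d (s≤s d≤c)) , (≤-trans d≤c c≤b , ≤-trans b≤a a≤1+d)

All-inits-∷⇔ : ∀ {A : Set} {P Q : List A → Set} {z w} →
  P [] → (∀ p → P (z ∷ p) ⇔ Q p) → All P (inits (z ∷ w)) ⇔ All Q (inits w)
All-inits-∷⇔ P[] P⇔Q = mk⇔ (All.map (Equivalence.to (P⇔Q _)) ∘ map⁻ ∘ All.tail)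
                            (λ qs → P[] ∷ map⁺ (All.map (Equivalence.from (P⇔Q _)) qs))

-- A linear order whose induced orientation satisfies the semi-transitivity condition for paths
-- of length three.
record ShortcutFreeOrder {V : Set} (E : V → V → Set) : Set₁ where
  field
    _<_                : V → V → Set
    isStrictTotalOrder : IsStrictTotalOrder _≡_ _<_
    shortcut           : ∀ {u v x z} → u < v → v < x → x < z →
                         E u v → E v x → E x z → E u z → E u x × E v z

  open IsStrictTotalOrder isStrictTotalOrder public

reverse : ∀ {V : Set} {E : V → V → Set} → Symmetric E → ShortcutFreeOrder E → ShortcutFreeOrder E
reverse E-sym O = record
  { _<_                = flip _<_
  ; isStrictTotalOrder = Flip.isStrictTotalOrder isStrictTotalOrder
  ; shortcut           = λ v<u x<v z<x uv vx xz uz →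
      let zv , xu = shortcut z<x x<v v<u (E-sym xz) (E-sym vx) (E-sym uv) (E-sym uz)
      in E-sym xu , E-sym zv
  }
  where open ShortcutFreeOrder O

module Words {V : Set} (_≟_ : DecidableEquality V) where

  open import Data.Nat using (_<_)

  data Letter (x y : V) : V → Set where
    first  : Letter x y x
    second : y ≢ x → Letter x y y
    other  : ∀ {z} → z ≢ x → z ≢ y → Letter x y z

  letter : ∀ x y z → Letter x y z
  letter x y z with z ≟ x | z ≟ y
  ... | yes refl | _        = first
  ... | no z≢x   | yes refl = second z≢x
  ... | no z≢x   | no z≢y   = other z≢x z≢y

  count : V → List V → ℕ
  count x = length ∘ filter (_≟ x)

  count-here : ∀ x p → count x (x ∷ p) ≡ suc (count x p)
  count-here x p = cong length (filter-accept (_≟ x) refl)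

  count-there : ∀ {x z} p → z ≢ x → count x (z ∷ p) ≡ count x p
  count-there p z≢x = cong length (filter-reject (_≟ _) z≢x)

  Balanced : V → V → List V → Set
  Balanced x y p = AtMostOneAhead (count x p) (count y p)

  balanced-here : ∀ {x y} → x ≢ y → ∀ p →
    AtMostOneAhead (count x (x ∷ p)) (count y (x ∷ p)) ⇔ Balanced y x p
  balanced-here {x} x≢y p rewrite count-here x p | count-there p x≢y =
    mk⇔ (λ (x≤1+y , 1+x≤1+y) → s≤s⁻¹ 1+x≤1+y , x≤1+y)
        (λ (x≤y , y≤1+x) → y≤1+x , s≤s x≤y)

  balanced-other : ∀ {x y z} → z ≢ x → z ≢ y → ∀ p →
    AtMostOneAhead (count x (z ∷ p)) (count y (z ∷ p)) ⇔ Balanced x y p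
  balanced-other {x} {y} z≢x z≢y p rewrite count-there p z≢x | count-there p z≢y = ⇔-id _

  unbalanced-second : ∀ {x y} → y ≢ x → ¬ AtMostOneAhead (count x (y ∷ [])) (count y (y ∷ []))
  unbalanced-second {y = y} y≢x (1≤0 , _) rewrite count-here y [] | count-there [] y≢x with 1≤0
  ... | ()

  x-or-y? : ∀ x y → Decidable (λ z → z ≡ x ⊎ z ≡ y)
  x-or-y? x y z = (z ≟ x) ⊎-dec (z ≟ y)

  restrict-first : ∀ x y w → restrict _≟_ (x ∷ w) x y ≡ x ∷ restrict _≟_ w x y
  restrict-first x y w = filter-accept (x-or-y? x y) (inj₁ refl)

  restrict-second : ∀ x y w → restrict _≟_ (y ∷ w) x y ≡ y ∷ restrict _≟_ w x y
  restrict-second x y w = filter-accept (x-or-y? x y) (inj₂ refl)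

  restrict-other : ∀ {x y z} w → z ≢ x → z ≢ y → restrict _≟_ (z ∷ w) x y ≡ restrict _≟_ w x y
  restrict-other {x} {y} w z≢x z≢y =
    filter-reject (x-or-y? x y) [ z≢x , z≢y ]

  restrict-comm : ∀ x y w → restrict _≟_ w x y ≡ restrict _≟_ w y x
  restrict-comm x y = filter-≐ (x-or-y? x y) (x-or-y? y x) (swap , swap)

  alternates-tail : ∀ {x : V} {l} → Alternates (x ∷ l) → Alternates l
  alternates-tail {l = []}    _         = _
  alternates-tail {l = _ ∷ _} (_ , alt) = alt

  -- Alternates (y ∷ l) says that l alternates and does not start with y.
  balanced⇔alternates : ∀ {x y} → x ≢ y → ∀ w →
    All (Balanced x y) (inits w) ⇔ Alternates (y ∷ restrict _≟_ w x y)
  balanced⇔alternates x≢y [] = mk⇔ (λ _ → _) (λ _ → (z≤n , z≤n) ∷ [])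
  balanced⇔alternates {x} {y} x≢y (z ∷ w) with letter x y z
  ... | first rewrite restrict-first x y w = begin
    All (Balanced x y) (inits (x ∷ w))      ≈⟨ All-inits-∷⇔ (z≤n , z≤n) (balanced-here x≢y) ⟩
    All (Balanced y x) (inits w)            ≈⟨ balanced⇔alternates (x≢y ∘ sym) w ⟩
    Alternates (x ∷ restrict _≟_ w y x)     ≡⟨ cong (Alternates ∘ (x ∷_)) (restrict-comm y x w) ⟩
    Alternates (x ∷ restrict _≟_ w x y)     ≈⟨ mk⇔ (x≢y ∘ sym ,_) proj₂ ⟩
    Alternates (y ∷ x ∷ restrict _≟_ w x y) ∎
    where open import Relation.Binary.Reasoning.Setoid (⇔-setoid 0ℓ)
  ... | second y≢x rewrite restrict-second x y w =
    mk⇔ (⊥-elim ∘ unbalanced-second y≢x ∘ All.head ∘ All.tail) (λ (y≢y , _) → ⊥-elim (y≢y refl))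
  ... | other z≢x z≢y rewrite restrict-other w z≢x z≢y =
    balanced⇔alternates x≢y w ⇔-∘ All-inits-∷⇔ (z≤n , z≤n) (balanced-other z≢x z≢y)

  firstIndex : V → List V → ℕ
  firstIndex x []      = 0
  firstIndex x (z ∷ w) with z ≟ x
  ... | yes _ = 0
  ... | no  _ = suc (firstIndex x w)

  firstIndex-injective : ∀ {x y} w → x ∈ w → firstIndex x w ≡ firstIndex y w → x ≡ y
  firstIndex-injective {x} {y} (z ∷ w) x∈zw eq with z ≟ x | z ≟ y
  ... | yes refl | yes refl = refl
  ... | no z≢x   | no _     = firstIndex-injective w (Any.tail (z≢x ∘ sym) x∈zw) (suc-injective eq)

  alternates-from-first : ∀ {x y} w → x ∈ w → firstIndex x w < firstIndex y w →
    Alternates (restrict _≟_ w x y) → Alternates (y ∷ restrict _≟_ w x y)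
  alternates-from-first {x} {y} (z ∷ w) x∈zw x<y alt with z ≟ x | z ≟ y
  ... | yes refl | no z≢y = (z≢y ∘ sym) , alt
  ... | no z≢x   | no z≢y =
    alternates-from-first w (Any.tail (z≢x ∘ sym) x∈zw) (s≤s⁻¹ x<y) alt

  wordRepresentable⇒shortcutFreeOrder : ∀ {E} → WordRepresentable V _≟_ E → ShortcutFreeOrder E
  wordRepresentable⇒shortcutFreeOrder {E} (w , w-covers , E⇔alternates) = record
    { _<_                = _⊏_
    ; isStrictTotalOrder = isStrictTotalOrderᶜ record
        { isEquivalence = ≡.isEquivalence ; trans = <-trans ; compare = compare }
    ; shortcut           = shortcut
    }
    where
      _⊏_ : V → V → Set
      x ⊏ y = firstIndex x w < firstIndex y w

      compare : Trichotomous _≡_ _⊏_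
      compare x y with <-cmp (firstIndex x w) (firstIndex y w)
      ... | tri< x⊏y ≉ ¬y⊏x = tri< x⊏y (≉ ∘ cong (λ v → firstIndex v w)) ¬y⊏x
      ... | tri≈ ¬x⊏y ≈ ¬y⊏x = tri≈ ¬x⊏y (firstIndex-injective w (w-covers x) ≈) ¬y⊏x
      ... | tri> ¬x⊏y ≉ y⊏x = tri> ¬x⊏y (≉ ∘ cong (λ v → firstIndex v w)) y⊏x

      ⊏⇒≢ : ∀ {x y} → x ⊏ y → x ≢ y
      ⊏⇒≢ x⊏x refl = <-irrefl refl x⊏x

      adjacent⇒balanced : ∀ {x y} → x ⊏ y → E x y → All (Balanced x y) (inits w)
      adjacent⇒balanced {x} {y} x⊏y xy = Equivalence.from (balanced⇔alternates (⊏⇒≢ x⊏y) w)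
        (alternates-from-first w (w-covers x) x⊏y (Equivalence.to (E⇔alternates x y (⊏⇒≢ x⊏y)) xy))

      balanced⇒adjacent : ∀ {x y} → x ≢ y → All (Balanced x y) (inits w) → E x y
      balanced⇒adjacent {x} {y} x≢y bal = Equivalence.from (E⇔alternates x y x≢y)
        (alternates-tail (Equivalence.to (balanced⇔alternates x≢y w) bal))

      shortcut : ∀ {u v x z} → u ⊏ v → v ⊏ x → x ⊏ z →
                 E u v → E v x → E x z → E u z → E u x × E v z
      shortcut {u} {v} {x} {z} u⊏v v⊏x x⊏z uv vx xz uz =
        balanced⇒adjacent (⊏⇒≢ (<-trans u⊏v v⊏x)) (proj₁ (All.unzip both)) ,
        balanced⇒adjacent (⊏⇒≢ (<-trans v⊏x x⊏z)) (proj₂ (All.unzip both))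
        where
          both : All (λ p → Balanced u x p × Balanced v z p) (inits w)
          both = All.zipWith (λ ((buv , bvx) , (bxz , buz)) → atMostOneAhead-shortcut buv bvx bxz buz)
            ( All.zip (adjacent⇒balanced u⊏v uv , adjacent⇒balanced v⊏x vx)
            , All.zip (adjacent⇒balanced x⊏z xz
                      , adjacent⇒balanced (<-trans u⊏v (<-trans v⊏x x⊏z)) uz))

module _ {A : Set} (_≺_ : A → A → Set) where

  IsMax : A → Set
  IsMax i = ∀ l → ¬ i ≺ l

  IsMin : A → Set
  IsMin j = ∀ l → ¬ l ≺ j

  Step : A → A → Set
  Step i j = i ≺ j × (∀ l → i ≺ l → ¬ l ≺ j)

  data CyclicSucc (i j : A) : Set where
    step : Step i j → CyclicSucc i j
    wrap : IsMax i → IsMin j → CyclicSucc i j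

cyclicSucc-flip : ∀ {A : Set} {_≺_ : A → A → Set} {i j} →
                  CyclicSucc _≺_ i j → CyclicSucc (flip _≺_) j i
cyclicSucc-flip (step (i≺j , nothing-between)) = step (i≺j , λ l l≺j i≺l → nothing-between l i≺l l≺j)
cyclicSucc-flip (wrap i-max j-min)              = wrap j-min i-max

module CyclicOrder {A : Set} {_≺_ : A → A → Set} (sto : IsStrictTotalOrder _≡_ _≺_) where

  open IsStrictTotalOrder sto

  ¬≺⇒≻ : ∀ {i l} → ¬ i ≺ l → l ≢ i → l ≺ i
  ¬≺⇒≻ {i} {l} i⊀l l≢i with compare i l
  ... | tri< i≺l _ _    = ⊥-elim (i⊀l i≺l)
  ... | tri≈ _ refl _   = ⊥-elim (l≢i refl)
  ... | tri> _ _ l≺i    = l≺i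

  max-unique : ∀ {i i'} → IsMax _≺_ i → IsMax _≺_ i' → i ≡ i'
  max-unique {i} {i'} i-max i'-max with compare i i'
  ... | tri< i≺i' _ _ = ⊥-elim (i-max i' i≺i')
  ... | tri≈ _ i≡i' _ = i≡i'
  ... | tri> _ _ i'≺i = ⊥-elim (i'-max i i'≺i)

  cyclicSucc-irrefl : ∀ {i l} → l ≢ i → ¬ CyclicSucc _≺_ i i
  cyclicSucc-irrefl l≢i (step (i≺i , _))   = irrefl refl i≺i
  cyclicSucc-irrefl l≢i (wrap i-max i-min) = i-max _ (¬≺⇒≻ (i-min _) (l≢i ∘ sym))

  cyclicSucc-injectiveˡ : ∀ {i i' j} → CyclicSucc _≺_ i j → CyclicSucc _≺_ i' j → i ≡ i'
  cyclicSucc-injectiveˡ {i} {i'} (step (i≺j , i-next)) (step (i'≺j , i'-next)) with compare i i'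
  ... | tri< i≺i' _ _ = ⊥-elim (i-next i' i≺i' i'≺j)
  ... | tri≈ _ i≡i' _ = i≡i'
  ... | tri> _ _ i'≺i = ⊥-elim (i'-next i i'≺i i≺j)
  cyclicSucc-injectiveˡ (step (i≺j , _)) (wrap _ j-min)       = ⊥-elim (j-min _ i≺j)
  cyclicSucc-injectiveˡ (wrap _ j-min)   (step (i'≺j , _))    = ⊥-elim (j-min _ i'≺j)
  cyclicSucc-injectiveˡ (wrap i-max _)   (wrap i'-max _)      = max-unique i-max i'-max

  cyclicSucc⇒step : ∀ {i j i'} → CyclicSucc _≺_ i j → IsMax _≺_ i' → i' ≢ i → Step _≺_ i j
  cyclicSucc⇒step (step i↝j)   _      _     = i↝j
  cyclicSucc⇒step (wrap i-max _) i'-max i'≢i = ⊥-elim (i'≢i (max-unique i'-max i-max))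

  outside-steps : ∀ {x y z w} → Step _≺_ x y → Step _≺_ y z →
                  w ≢ x → w ≢ y → w ≢ z → w ≺ x ⊎ z ≺ w
  outside-steps {x} {y} {z} {w} (x≺y , x-next) (y≺z , y-next) w≢x w≢y w≢z with compare w x
  ... | tri< w≺x _ _ = inj₁ w≺x
  ... | tri≈ _ w≡x _ = ⊥-elim (w≢x w≡x)
  ... | tri> _ _ x≺w = inj₂ (¬≺⇒≻ (y-next w y≺w) (w≢z ∘ sym))
    where y≺w : y ≺ w
          y≺w = ¬≺⇒≻ (x-next w x≺w) (w≢y ∘ sym)

module _ {n} {_≺_ : Fin n → Fin n → Set} (sto : IsStrictTotalOrder _≡_ _≺_) where

  open IsStrictTotalOrder sto

  minimal : ∀ {P : Fin n → Set} → Decidable P → ∀ {x} → P x →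
            ∃[ m ] P m × (∀ l → P l → ¬ l ≺ m)
  minimal {P} P? {x} Px = go (spo-wellFounded isStrictPartialOrder x) Px
    where
      go : ∀ {x} → Acc _≺_ x → P x → ∃[ m ] P m × (∀ l → P l → ¬ l ≺ m)
      go {x} (acc smaller) Px with any? (λ l → P? l ×-dec (l <? x))
      ... | yes (l , Pl , l≺x) = go (smaller l≺x) Pl
      ... | no ∄l            = x , Px , λ l Pl l≺x → ∄l (l , Pl , l≺x)

  cyclicSucc-exists : ∀ i → ∃[ j ] CyclicSucc _≺_ i j
  cyclicSucc-exists i with any? (i <?_)
  ... | yes (_ , i≺l) = let (j , i≺j , j-least) = minimal (i <?_) i≺l in
    j , step (i≺j , j-least)
  ... | no ∄l = let (j , _ , j-least) = minimal {P = λ _ → ⊤} (λ _ → yes tt) {i} tt in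
    j , wrap (λ l i≺l → ∄l (l , i≺l)) (λ l → j-least l tt)

module ShortcutFree {V : Set} {E : V → V → Set} (E-sym : Symmetric E) (O : ShortcutFreeOrder E) where

  open ShortcutFreeOrder O

  skipped⇒between : ∀ {t x y z} → x < y → y < z → E x y → E y z →
                    E t x → E t z → ¬ E t y → x < t × t < z
  skipped⇒between {t} {x} {y} {z} x<y y<z xy yz tx tz ¬ty with compare t x | compare t z
  ... | tri< t<x _ _ | _            = ⊥-elim (¬ty (proj₁ (shortcut t<x x<y y<z tx xy yz tz)))
  ... | tri≈ _ refl _ | _           = ⊥-elim (¬ty xy)
  ... | tri> _ _ x<t | tri< t<z _ _ = x<t , t<z
  ... | tri> _ _ _   | tri≈ _ refl _ = ⊥-elim (¬ty (E-sym yz))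
  ... | tri> _ _ _   | tri> _ _ z<t =
    ⊥-elim (¬ty (E-sym (proj₂ (shortcut x<y y<z z<t xy yz (E-sym tz) (E-sym tx)))))

  between⇒adjacent : ∀ {t x y z} → x < t → t < y → z < x ⊎ y < z →
                     E x z → E y z → E t x → E t y → E t z
  between⇒adjacent x<t t<y (inj₁ z<x) xz yz tx ty =
    E-sym (proj₁ (shortcut z<x x<t t<y (E-sym xz) (E-sym tx) ty (E-sym yz)))
  between⇒adjacent x<t t<y (inj₂ y<z) xz yz tx ty =
    proj₂ (shortcut x<t t<y y<z (E-sym tx) ty yz xz)

  between-transfer : ∀ {s t u w} → u < s → s < w → E s u → E s w → E t u → E t w → ¬ E s t →
                     u < t × t < w
  between-transfer {s} {t} {u} {w} u<s s<w su sw tu tw ¬st with compare t u | compare t w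
  ... | tri< t<u _ _ | _             = ⊥-elim (¬st (E-sym (proj₁ (shortcut t<u u<s s<w tu (E-sym su) sw tw))))
  ... | tri≈ _ refl _ | _            = ⊥-elim (¬st su)
  ... | tri> _ _ u<t | tri< t<w _ _  = u<t , t<w
  ... | tri> _ _ _   | tri≈ _ refl _ = ⊥-elim (¬st sw)
  ... | tri> _ _ _   | tri> _ _ w<t  =
    ⊥-elim (¬st (proj₂ (shortcut u<s s<w w<t (E-sym su) sw (E-sym tw) (E-sym tu))))

  module Clique {n} (κ : Fin n → V) (κ-injective : ∀ {i j} → κ i ≡ κ j → i ≡ j)
                (κ-clique : ∀ {i j} → i ≢ j → E (κ i) (κ j)) where

    _≺_ : Fin n → Fin n → Set
    _≺_ = _<_ on κ

    ≺-isStrictTotalOrder : IsStrictTotalOrder _≡_ _≺_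
    ≺-isStrictTotalOrder = isStrictTotalOrderᶜ record
      { isEquivalence = ≡.isEquivalence ; trans = trans ; compare = compare-κ }
      where
        compare-κ : Trichotomous _≡_ _≺_
        compare-κ i j with compare (κ i) (κ j)
        ... | tri< i≺j ≉ ¬j≺i = tri< i≺j (≉ ∘ cong κ) ¬j≺i
        ... | tri≈ ¬i≺j ≈ ¬j≺i = tri≈ ¬i≺j (κ-injective ≈) ¬j≺i
        ... | tri> ¬i≺j ≉ j≺i = tri> ¬i≺j (≉ ∘ cong κ) j≺i

    open CyclicOrder ≺-isStrictTotalOrder using (outside-steps)
    open IsStrictTotalOrder ≺-isStrictTotalOrder using () renaming (_<?_ to _≺?_)

    ≺⇒≢ : ∀ {i j} → i ≺ j → i ≢ j
    ≺⇒≢ i≺i refl = irrefl refl i≺i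

    ordered-neighbours⇒cyclicSucc : ∀ {t j j'} → j ≺ j' → E t (κ j) → E t (κ j') →
      (∀ l → l ≢ j → l ≢ j' → ¬ E t (κ l)) → CyclicSucc _≺_ j j' ⊎ CyclicSucc _≺_ j' j
    ordered-neighbours⇒cyclicSucc {t} {j} {j'} j≺j' tj tj' only with any? (λ l → (j ≺? l) ×-dec (l ≺? j'))
    ... | no ∄l = inj₁ (step (j≺j' , λ l j≺l l≺j' → ∄l (l , j≺l , l≺j')))
    ... | yes (l , j≺l , l≺j') = inj₂ (wrap j'-max j-min)
      where
        j<t<j' : κ j < t × t < κ j'
        j<t<j' = skipped⇒between j≺l l≺j' (κ-clique (≺⇒≢ j≺l)) (κ-clique (≺⇒≢ l≺j')) tj tj'
                   (only l (≺⇒≢ j≺l ∘ sym) (≺⇒≢ l≺j'))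

        outside⇒⊥ : ∀ {l} → l ≺ j ⊎ j' ≺ l → l ≢ j → l ≢ j' → ⊥
        outside⇒⊥ {l} outside l≢j l≢j' = only l l≢j l≢j' (between⇒adjacent
          (proj₁ j<t<j') (proj₂ j<t<j') outside (κ-clique (l≢j ∘ sym)) (κ-clique (l≢j' ∘ sym)) tj tj')

        j'-max : IsMax _≺_ j'
        j'-max l j'≺l = outside⇒⊥ (inj₂ j'≺l) (≺⇒≢ (trans j≺j' j'≺l) ∘ sym) (≺⇒≢ j'≺l ∘ sym)

        j-min : IsMin _≺_ j
        j-min l l≺j = outside⇒⊥ (inj₁ l≺j) (≺⇒≢ l≺j) (≺⇒≢ (trans l≺j j≺j'))

    neighbours⇒cyclicSucc : ∀ {t j j'} → j ≢ j' → E t (κ j) → E t (κ j') →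
      (∀ l → l ≢ j → l ≢ j' → ¬ E t (κ l)) → CyclicSucc _≺_ j j' ⊎ CyclicSucc _≺_ j' j
    neighbours⇒cyclicSucc {j = j} {j'} j≢j' tj tj' only with compare (κ j) (κ j')
    ... | tri< j≺j' _ _ = ordered-neighbours⇒cyclicSucc j≺j' tj tj' only
    ... | tri≈ _ j≈j' _ = ⊥-elim (j≢j' (κ-injective j≈j'))
    ... | tri> _ _ j'≺j =
      swap (ordered-neighbours⇒cyclicSucc j'≺j tj' tj λ l l≢j' l≢j → only l l≢j l≢j')

    split-obstruction : ∀ {x y z w s t} → Step _≺_ x y → Step _≺_ y z → w ≢ x → w ≢ y → w ≢ z →
      E s (κ x) → E s (κ z) → ¬ E s (κ y) → E t (κ x) → E t (κ z) → ¬ E t (κ w) → ¬ E s t → ⊥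
    split-obstruction {x} {y} {z} {w} {s} {t} x↝y y↝z w≢x w≢y w≢z sx sz ¬sy tx tz ¬tw ¬st =
      ¬tw (between⇒adjacent (proj₁ x<t<z) (proj₂ x<t<z) (outside-steps x↝y y↝z w≢x w≢y w≢z)
             (κ-clique (w≢x ∘ sym)) (κ-clique (w≢z ∘ sym)) tx tz)
      where
        x≺y : x ≺ y
        x≺y = proj₁ x↝y
        y≺z : y ≺ z
        y≺z = proj₁ y↝z
        x<s<z : κ x < s × s < κ z
        x<s<z = skipped⇒between x≺y y≺z (κ-clique (≺⇒≢ x≺y)) (κ-clique (≺⇒≢ y≺z)) sx sz ¬sy
        x<t<z : κ x < t × t < κ z
        x<t<z = between-transfer (proj₁ x<s<z) (proj₂ x<s<z) sx sz tx tz ¬st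

clamp : ∀ {n} → ℕ → Fin (suc n)
clamp         zero    = zero
clamp {zero}  (suc i) = zero
clamp {suc n} (suc i) = suc (clamp i)

toℕ-clamp : ∀ {n} i → i ≤ n → toℕ (clamp {n} i) ≡ i
toℕ-clamp zero    _         = refl
toℕ-clamp (suc i) (s≤s i≤n) = cong suc (toℕ-clamp i i≤n)

clamp-toℕ : ∀ {n} (j : Fin (suc n)) → clamp (toℕ j) ≡ j
clamp-toℕ         zero    = refl
clamp-toℕ {suc n} (suc j) = cong suc (clamp-toℕ j)

AdjMII-sym : ∀ {k} → Symmetric (AdjMII {k})
AdjMII-sym (cc i j i≢j) = cc j i (i≢j ∘ sym)
AdjMII-sym (ic x j xj)  = ci x j xj
AdjMII-sym (ci x j xj)  = ic x j xj

c-injective : ∀ {k} {i j : Fin k} → MV.c i ≡ c j → i ≡ j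
c-injective refl = refl

module MII (m : ℕ) where

  K : ℕ
  K = suc (suc (suc (suc m)))

  -- Indices are 0-based as in Defs; clamp turns out-of-range indices into junk, hence the bounds.
  C : ℕ → Fin K
  C = clamp

  A : ℕ → Fin (K ∸ 2)
  A = clamp

  toℕ-C : ∀ {i} → i ≤ 3 + m → toℕ (C i) ≡ i
  toℕ-C = toℕ-clamp _

  C-injective : ∀ {i j} → i ≤ 3 + m → j ≤ 3 + m → C i ≡ C j → i ≡ j
  C-injective i≤ j≤ Ci≡Cj = ≡.trans (sym (toℕ-C i≤)) (≡.trans (cong toℕ Ci≡Cj) (toℕ-C j≤))

  toℕ≡⇒≡C : ∀ {j i} → toℕ j ≡ i → j ≡ C i
  toℕ≡⇒≡C {j} j≡i = ≡.trans (sym (clamp-toℕ j)) (cong clamp j≡i)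

  n≤1+m⇒n≤3+m : ∀ {n} → n ≤ suc m → n ≤ 3 + m
  n≤1+m⇒n≤3+m = m≤n⇒m≤1+n ∘ m≤n⇒m≤1+n

  n≤1+m⇒1+n≤3+m : ∀ {n} → n ≤ suc m → suc n ≤ 3 + m
  n≤1+m⇒1+n≤3+m = m≤n⇒m≤1+n ∘ s≤s

  1+m≤3+m : 1 + m ≤ 3 + m
  1+m≤3+m = ≤-trans (n≤1+n _) (n≤1+n _)

  2+m≤3+m : 2 + m ≤ 3 + m
  2+m≤3+m = n≤1+n _

  a-left : ∀ {n} → n ≤ suc m → AdjMII (a (A n)) (c (C n))
  a-left n≤ = ic _ _ (ac₀ _ _ (≡.trans (toℕ-C (n≤1+m⇒n≤3+m n≤)) (sym (toℕ-clamp _ n≤))))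

  a-right : ∀ {n} → n ≤ suc m → AdjMII (a (A n)) (c (C (suc n)))
  a-right n≤ =
    ic _ _ (ac₁ _ _ (≡.trans (toℕ-C (n≤1+m⇒1+n≤3+m n≤)) (cong suc (sym (toℕ-clamp _ n≤)))))

  a-only : ∀ {n l} → n ≤ suc m → AdjMII (a (A n)) (c l) → l ≡ C n ⊎ l ≡ C (suc n)
  a-only n≤ (ic _ _ (ac₀ _ _ l≡n))   = inj₁ (toℕ≡⇒≡C (≡.trans l≡n (toℕ-clamp _ n≤)))
  a-only n≤ (ic _ _ (ac₁ _ _ l≡1+n)) =
    inj₂ (toℕ≡⇒≡C (≡.trans l≡1+n (cong suc (toℕ-clamp _ n≤))))

  b₁-adj : ∀ {i} → i ≤ 3 + m → i ≢ 2 + m → AdjMII b₁ (c (C i))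
  b₁-adj i≤ i≢2+m = ic _ _ (b₁c _ (i≢2+m ∘ ≡.trans (sym (toℕ-C i≤))))

  b₁-nonadj : ¬ AdjMII b₁ (c (C (2 + m)))
  b₁-nonadj (ic _ _ (b₁c _ ≢2+m)) = ≢2+m (toℕ-C 2+m≤3+m)

  b₂-adj : ∀ {i} → i ≤ 3 + m → i ≢ 0 → AdjMII b₂ (c (C i))
  b₂-adj i≤ i≢0 = ic _ _ (b₂c _ (i≢0 ∘ ≡.trans (sym (toℕ-C i≤))))

  b₂-nonadj : ¬ AdjMII b₂ (c (C 0))
  b₂-nonadj (ic _ _ (b₂c _ ≢0)) = ≢0 refl

  C₁₊ₘ≢C₃₊ₘ : C (1 + m) ≢ C (3 + m)
  C₁₊ₘ≢C₃₊ₘ = <⇒≢ (n≤1+n _) ∘ C-injective 1+m≤3+m ≤-refl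

  C₂₊ₘ≢C₃₊ₘ : C (2 + m) ≢ C (3 + m)
  C₂₊ₘ≢C₃₊ₘ = <⇒≢ (n<1+n _) ∘ C-injective 2+m≤3+m ≤-refl

  module Order (O : ShortcutFreeOrder (AdjMII {K})) where

    open ShortcutFree AdjMII-sym O
    open Clique c c-injective (cc _ _)
    open CyclicOrder ≺-isStrictTotalOrder

    infix 4 _↦_
    _↦_ : Fin K → Fin K → Set
    _↦_ = CyclicSucc _≺_

    chain-link : ∀ n → n ≤ suc m → C n ↦ C (suc n) ⊎ C (suc n) ↦ C n
    chain-link n n≤ = neighbours⇒cyclicSucc
      (<⇒≢ (n<1+n n) ∘ C-injective (n≤1+m⇒n≤3+m n≤) (n≤1+m⇒1+n≤3+m n≤))
      (a-left n≤) (a-right n≤) (λ l l≢Cn l≢C1+n → [ l≢Cn , l≢C1+n ] ∘ a-only n≤)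

    module _ (C₀↦C₁ : C 0 ↦ C 1) where

      forward : ∀ n → n ≤ suc m → C n ↦ C (suc n)
      forward zero    _     = C₀↦C₁
      forward (suc n) 1+n≤ with chain-link (suc n) 1+n≤
      ... | inj₁ Cn↦ = Cn↦
      ... | inj₂ C2+n↦ = ⊥-elim (<⇒≢ (n≤1+n (suc n))
        (C-injective (n≤1+m⇒n≤3+m (<⇒≤ 1+n≤)) (n≤1+m⇒1+n≤3+m 1+n≤)
          (cyclicSucc-injectiveˡ (forward n (<⇒≤ 1+n≤)) C2+n↦)))

      successor-index : ∀ {i j} → i ↦ j → toℕ j ≡ 0 ⊎ toℕ j ≡ 3 + m ⊎ toℕ j ≡ suc (toℕ i)
      successor-index {j = zero}      _   = inj₁ refl
      successor-index {i} {j = suc j} i↦ with toℕ j ≤? suc m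
      ... | yes j≤ = inj₂ (inj₂ (cong suc (sym (≡.trans (cong toℕ i≡Cj) (toℕ-C (n≤1+m⇒n≤3+m j≤))))))
        where
          i≡Cj : i ≡ C (toℕ j)
          i≡Cj = cyclicSucc-injectiveˡ (subst (i ↦_) (toℕ≡⇒≡C refl) i↦) (forward (toℕ j) j≤)
      ... | no j≰ = inj₂ (inj₁ (cong suc (≤-antisym (s≤s⁻¹ (toℕ<n j)) (≰⇒> j≰))))

      last↦first : C (3 + m) ↦ C 0
      last↦first with cyclicSucc-exists ≺-isStrictTotalOrder (C (3 + m))
      ... | j , last↦j with successor-index last↦j
      ...   | inj₁ j≡0          = subst (_ ↦_) (toℕ≡⇒≡C j≡0) last↦j
      ...   | inj₂ (inj₁ j≡3+m) =
        ⊥-elim (cyclicSucc-irrefl {l = C 0} (λ ()) (subst (_ ↦_) (toℕ≡⇒≡C j≡3+m) last↦j))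
      ...   | inj₂ (inj₂ j≡4+m) = ⊥-elim (<⇒≢ (toℕ<n j) (≡.trans j≡4+m (cong suc (toℕ-C ≤-refl))))

      second-last↦last : C (2 + m) ↦ C (3 + m)
      second-last↦last with cyclicSucc-exists ≺-isStrictTotalOrder (C (2 + m))
      ... | j , second-last↦j with successor-index second-last↦j
      ...   | inj₁ j≡0          = ⊥-elim (<⇒≢ (n<1+n (2 + m)) (C-injective 2+m≤3+m ≤-refl
              (cyclicSucc-injectiveˡ (subst (_ ↦_) (toℕ≡⇒≡C j≡0) second-last↦j) last↦first)))
      ...   | inj₂ (inj₁ j≡3+m) = subst (_ ↦_) (toℕ≡⇒≡C j≡3+m) second-last↦j
      ...   | inj₂ (inj₂ j≡3+m) =
        subst (_ ↦_) (toℕ≡⇒≡C (≡.trans j≡3+m (cong suc (toℕ-C 2+m≤3+m)))) second-last↦j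

      max-elsewhere⇒⊥ : ∀ {i} → IsMax _≺_ i → i ≢ C (3 + m) → i ≢ C 0 → ⊥
      max-elsewhere⇒⊥ i-max i≢last i≢first = split-obstruction
        (cyclicSucc⇒step last↦first i-max i≢last) (cyclicSucc⇒step C₀↦C₁ i-max i≢first)
        C₂₊ₘ≢C₃₊ₘ (λ ()) (λ ())
        (b₂-adj ≤-refl λ ()) (b₂-adj (s≤s z≤n) λ ()) b₂-nonadj
        (b₁-adj ≤-refl (<⇒≢ (n<1+n _) ∘ sym)) (b₁-adj (s≤s z≤n) λ ()) b₁-nonadj
        (λ ())

    -- The cycle C 0 ↦ C 1 ↦ ... ↦ C (3 + m) ↦ C 0 wraps around at exactly one arrow; apply the
    -- obstruction to whichever of the triples C (1 + m), C (2 + m), C (3 + m) and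
    -- C (3 + m), C 0, C 1 avoids it.
    refute : C 0 ↦ C 1 → ⊥
    refute C₀↦C₁ with forward C₀↦C₁ (suc m) ≤-refl | second-last↦last C₀↦C₁
    ... | step s₁      | step s₂      = split-obstruction s₁ s₂ (λ ()) (λ ()) (λ ())
      (b₁-adj 1+m≤3+m (<⇒≢ (n<1+n _))) (b₁-adj ≤-refl (<⇒≢ (n<1+n _) ∘ sym)) b₁-nonadj
      (b₂-adj 1+m≤3+m λ ()) (b₂-adj ≤-refl λ ()) b₂-nonadj
      (λ ())
    ... | wrap i-max _ | _            = max-elsewhere⇒⊥ C₀↦C₁ i-max C₁₊ₘ≢C₃₊ₘ (λ ())
    ... | step _       | wrap i-max _ = max-elsewhere⇒⊥ C₀↦C₁ i-max C₂₊ₘ≢C₃₊ₘ (λ ())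

  not-wordRepresentable : ¬ WordRepresentable (MV K) _≟MV_ AdjMII
  not-wordRepresentable rep = [ refute O , refute (reverse AdjMII-sym O) ∘ cyclicSucc-flip ]
                                (chain-link O 0 z≤n)
    where
      O : ShortcutFreeOrder AdjMII
      O = Words.wordRepresentable⇒shortcutFreeOrder _≟MV_ rep
      open Order using (refute; chain-link)

lemma10 : (k : ℕ) → 2 ∣ k → 4 ≤ k → ¬ WordRepresentable (MV k) _≟MV_ AdjMII
lemma10 _ _ (s≤s (s≤s (s≤s (s≤s {n = m} _)))) = MII.not-wordRepresentable m
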